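{- Let $a,b,c,d$ be four distinct letters and $\mu$, $f_{m,n}$ as in the context. Let $m,n\ge2$ with $m\neq n$. Then $$f_{m,n}=\begin{cases}\mu^{m-1}(f_{1,n-m+1}) & \text{if } m<n,\\ \mu^{n-1}(f_{m-n+1,1}) & \text{if } m>n.\end{cases}$$
   Context: For arrays $u,v$ with equal numbers of rows, $u\circ_c v$ places $v$ to the right of $u$; with equal numbers of columns, $u\circ_r v$ places $v$ below $u$. Two-dimensional Fibonacci arrays: $f_{0,0}=a$, $f_{0,1}=b$, $f_{1,0}=c$, $f_{1,1}=d$, and for $k\ge0$, $m,n\ge1$: $f_{k,n+1}=f_{k,n}\circ_c f_{k,n-1}$, $f_{m+1,k}=f_{m,k}\circ_r f_{m-1,k}$. $\mu(d)=\begin{smallmatrix} d & c\\ b & a\end{smallmatrix}$, $\mu(c)=\begin{smallmatrix} d\\ b\end{smallmatrix}$ ($2\times1$), $\mu(b)=\begin{smallmatrix} d & c\end{smallmatrix}$ ($1\times2$), $\mu(a)=d$. For an array $x=[x_{i,j}]$ of size $(p,q)$ such that for each $i$ all $\mu(x_{i,j})$ have the same number of rows and for each $j$ all $\mu(x_{i,j})$ have the same number of columns, $\mu(x)=R_1\circ_r\cdots\circ_r R_p$ with $R_i=\mu(x_{i,1})\circ_c\cdots\circ_c\mu(x_{i,q})$; $\mu^k$ denotes the $k$-fold iterate. -}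

module Defs where

open import Data.Nat using (ℕ; zero; suc; _+_; _≟_)
open import Data.List using (List; []; _∷_)
open import Data.List.Properties using (≡-dec)
open import Data.Vec using (Vec; []; _∷_; _++_; zipWith)
open import Data.Product using (Σ; _,_)
open import Data.Maybe using (Maybe; just; nothing; _>>=_)
open import Relation.Nullary using (yes; no)
open import Relation.Binary.PropositionalEquality using (_≡_; refl; subst)

data Letter : Set where
  a b c d : Letter

F : ℕ → ℕ
F 0 = 1
F 1 = 1
F (suc (suc n)) = F (suc n) + F n

Mat : ℕ → ℕ → Set
Mat p q = Vec (Vec Letter q) p

Array : Set
Array = Σ ℕ λ p → Σ ℕ λ q → Mat p q

_∘c_ : ∀ {p q r} → Mat p q → Mat p r → Mat p (q + r)
u ∘c v = zipWith _++_ u v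

_∘r_ : ∀ {p q r} → Mat p r → Mat q r → Mat (p + q) r
u ∘r v = u ++ v

-- Rows 0 and 1 are built by the column recursion, all further rows by the
-- row recursion (the two recursions of the paper agree where they overlap).
fib2 : (m n : ℕ) → Mat (F m) (F n)
fib2 0 0 = (a ∷ []) ∷ []
fib2 0 1 = (b ∷ []) ∷ []
fib2 1 0 = (c ∷ []) ∷ []
fib2 1 1 = (d ∷ []) ∷ []
fib2 0 (suc (suc n)) = fib2 0 (suc n) ∘c fib2 0 n
fib2 1 (suc (suc n)) = fib2 1 (suc n) ∘c fib2 1 n
fib2 (suc (suc m)) n = fib2 (suc m) n ∘r fib2 m n

fibArr : ℕ → ℕ → Array
fibArr m n = F m , F n , fib2 m n

img : Letter → Array
img d = 2 , 2 , (d ∷ c ∷ []) ∷ (b ∷ a ∷ []) ∷ []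
img c = 2 , 1 , (d ∷ []) ∷ (b ∷ []) ∷ []
img b = 1 , 2 , (d ∷ c ∷ []) ∷ []
img a = 1 , 1 , (d ∷ []) ∷ []

sumL : List ℕ → ℕ
sumL [] = 0
sumL (w ∷ ws) = w + sumL ws

-- image of one row x_{i,1} ... x_{i,q}: common height h, the list of the
-- column counts of μ(x_{i,j}), and the concatenation R_i.
-- Undefined (nothing) if the heights differ (or the row is empty).
RowImg : Set
RowImg = Σ ℕ λ h → Σ (List ℕ) λ ws → Mat h (sumL ws)

μrow : ∀ {q} → Vec Letter q → Maybe RowImg
μrow [] = nothing
μrow (x ∷ []) with img x
... | h , w , blk = just (h , w ∷ [] , subst (Mat h) (sym0 w) blk)
  where
  sym0 : ∀ w → w ≡ w + 0
  sym0 zero = refl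
  sym0 (suc w) with w + 0 | sym0 w
  ... | .w | refl = refl
μrow (x ∷ y ∷ xs) with img x | μrow (y ∷ xs)
... | h , w , blk | nothing = nothing
... | h , w , blk | just (h' , ws , rest) with h ≟ h'
...   | no _ = nothing
...   | yes refl = just (h , w ∷ ws , blk ∘c rest)

-- image of the whole array: R_1 ∘r ... ∘r R_p, defined only if for each
-- column j all μ(x_{i,j}) have the same number of columns (equal lists ws).
ColImg : Set
ColImg = Σ (List ℕ) λ ws → Σ ℕ λ H → Mat H (sumL ws)

μrows : ∀ {p q} → Mat p q → Maybe ColImg
μrows [] = nothing
μrows (r ∷ []) with μrow r
... | nothing = nothing
... | just (h , ws , blk) = just (ws , h , blk)
μrows (r ∷ r' ∷ rs) with μrow r | μrows (r' ∷ rs)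
... | nothing | _ = nothing
... | just _ | nothing = nothing
... | just (h , ws , blk) | just (ws' , H , rest) with ≡-dec _≟_ ws ws'
...   | no _ = nothing
...   | yes refl = just (ws , h + H , blk ∘r rest)

μ : Array → Maybe Array
μ (p , q , x) with μrows x
... | nothing = nothing
... | just (ws , H , blk) = just (H , sumL ws , blk)

μ^ : ℕ → Array → Maybe Array
μ^ zero x = just x
μ^ (suc k) x = μ^ k x >>= μ

-- Read each letter as a pair of bits (row bit, column bit): a = 00, b = 01,
-- c = 10, d = 11.  Then f_{m,n} is the "outer product" w_m ⊗ w_n of the
-- Fibonacci words w_0 = 0, w_1 = 1, w_{n+2} = w_{n+1} w_n, and μ acts on an
-- outer product u ⊗ v as φ(u) ⊗ φ(v), where φ(1) = 10, φ(0) = 1 is the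
-- Fibonacci morphism.  Since φ(w_n) = w_{n+1}, we get μ(f_{m,n}) = f_{m+1,n+1},
-- hence μ^k(f_{m,n}) = f_{m+k,n+k}, and the theorem is the case k = min m n - 1
-- (valid already for m, n ≥ 1).
module Submission where

open import Defs
open import Data.Nat using (ℕ; zero; suc; _≤_; _<_; _∸_; _+_; _≟_; s≤s; NonZero)
open import Data.Nat.Properties using (+-comm; +-assoc; m+[n∸m]≡n; <⇒≤)
open import Data.Bool using (Bool; true; false)
open import Data.List using (List; []; _∷_)
open import Data.List.Properties using (≡-dec)
open import Data.Vec using (Vec; []; _∷_; _++_; map)
open import Data.Vec.Properties using (map-++)
open import Data.Product using (Σ; _×_; _,_)
open import Data.Maybe using (just)
open import Relation.Binary.PropositionalEquality
  using (_≡_; _≢_; refl; cong; cong₂; sym; trans; ≡-≟-identity; module ≡-Reasoning)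

letter : Bool → Bool → Letter
letter false false = a
letter false true  = b
letter true  false = c
letter true  true  = d

_⊗_ : ∀ {p q} → Vec Bool p → Vec Bool q → Mat p q
u ⊗ v = map (λ r → map (letter r) v) u

⊗-++ʳ : ∀ {p q r} (u : Vec Bool p) (v : Vec Bool q) (v′ : Vec Bool r) →
  (u ⊗ v) ∘c (u ⊗ v′) ≡ u ⊗ (v ++ v′)
⊗-++ʳ []      v v′ = refl
⊗-++ʳ (r ∷ u) v v′ = cong₂ _∷_ (sym (map-++ (letter r) v v′)) (⊗-++ʳ u v v′)

⊗-++ˡ : ∀ {p q r} (u : Vec Bool p) (u′ : Vec Bool q) (v : Vec Bool r) →
  (u ⊗ v) ∘r (u′ ⊗ v) ≡ (u ++ u′) ⊗ v
⊗-++ˡ u u′ v = sym (map-++ _ u u′)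

-- φ v is indexed by sumL (φ-lengths v), literally the width that μ computes.

φ-length : Bool → ℕ
φ-length true  = 2
φ-length false = 1

φ-bit : (x : Bool) → Vec Bool (φ-length x)
φ-bit true  = true ∷ false ∷ []
φ-bit false = true ∷ []

φ-lengths : ∀ {q} → Vec Bool q → List ℕ
φ-lengths []      = []
φ-lengths (x ∷ v) = φ-length x ∷ φ-lengths v

φ : ∀ {q} (v : Vec Bool q) → Vec Bool (sumL (φ-lengths v))
φ []      = []
φ (x ∷ v) = φ-bit x ++ φ v

img-letter : ∀ r s → img (letter r s) ≡ (φ-length r , φ-length s , φ-bit r ⊗ φ-bit s)
img-letter false false = refl
img-letter false true  = refl
img-letter true  false = refl
img-letter true  true  = refl

μrow-∷ : ∀ l {q} (xs : Vec Letter (suc q)) {h w blk ws row} →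
  img l ≡ (h , w , blk) → μrow xs ≡ just (h , ws , row) →
  μrow (l ∷ xs) ≡ just (h , w ∷ ws , blk ∘c row)
μrow-∷ l (_ ∷ _) {h} img≡ μrow≡ rewrite img≡ | μrow≡ | ≡-≟-identity _≟_ {h} refl = refl

μrows-∷ : ∀ {p q} (row : Vec Letter q) (rows : Mat (suc p) q) {h ws blk H rest} →
  μrow row ≡ just (h , ws , blk) → μrows rows ≡ just (ws , H , rest) →
  μrows (row ∷ rows) ≡ just (ws , h + H , blk ∘r rest)
μrows-∷ row (_ ∷ _) {ws = ws} μrow≡ μrows≡
  rewrite μrow≡ | μrows≡ | ≡-≟-identity (≡-dec _≟_) {ws} refl = refl

μrow-map-letter : ∀ r {q} (v : Vec Bool (suc q)) →
  μrow (map (letter r) v) ≡ just (φ-length r , φ-lengths v , φ-bit r ⊗ φ v)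
μrow-map-letter false (false ∷ []) = refl
μrow-map-letter false (true  ∷ []) = refl
μrow-map-letter true  (false ∷ []) = refl
μrow-map-letter true  (true  ∷ []) = refl
μrow-map-letter r (s ∷ v@(_ ∷ _)) =
  trans (μrow-∷ (letter r s) (map (letter r) v) (img-letter r s) (μrow-map-letter r v))
        (cong (λ blk → just (_ , _ , blk)) (⊗-++ʳ (φ-bit r) (φ-bit s) (φ v)))

μrows-⊗ : ∀ {p q} (u : Vec Bool (suc p)) (v : Vec Bool (suc q)) →
  μrows (u ⊗ v) ≡ just (φ-lengths v , sumL (φ-lengths u) , φ u ⊗ φ v)
μrows-⊗ (false ∷ []) v rewrite μrow-map-letter false v = refl
μrows-⊗ (true  ∷ []) v rewrite μrow-map-letter true  v = refl
μrows-⊗ (r ∷ u@(_ ∷ _)) v =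
  trans (μrows-∷ (map (letter r) v) (u ⊗ v) (μrow-map-letter r v) (μrows-⊗ u v))
        (cong (λ blk → just (_ , _ , blk)) (⊗-++ˡ (φ-bit r) (φ u) (φ v)))

-- Words are packed with their length, so that words of propositionally but not
-- definitionally equal lengths can be compared.

Word : Set
Word = Σ ℕ (Vec Bool)

_⊠_ : Word → Word → Array
(p , u) ⊠ (q , v) = p , q , u ⊗ v

_⧺_ : Word → Word → Word
(p , u) ⧺ (q , v) = p + q , u ++ v

φʷ : Word → Word
φʷ (_ , u) = _ , φ u

μ-⊗ : ∀ {p q} (u : Vec Bool p) (v : Vec Bool q) → .{{NonZero p}} → .{{NonZero q}} →
  μ ((p , u) ⊠ (q , v)) ≡ just (φʷ (p , u) ⊠ φʷ (q , v))
μ-⊗ u@(_ ∷ _) v@(_ ∷ _) rewrite μrows-⊗ u v = refl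

⧺-assoc : ∀ x y z → (x ⧺ y) ⧺ z ≡ x ⧺ (y ⧺ z)
⧺-assoc (_ , [])    y z = refl
⧺-assoc (_ , r ∷ u) y z = cong (λ (k , t) → suc k , r ∷ t) (⧺-assoc (_ , u) y z)

φʷ-⧺ : ∀ x y → φʷ (x ⧺ y) ≡ φʷ x ⧺ φʷ y
φʷ-⧺ (_ , [])    y = refl
φʷ-⧺ (_ , r ∷ u) y = begin
  φʷ ((_ , r ∷ u) ⧺ y)              ≡⟨ cong ((_ , φ-bit r) ⧺_) (φʷ-⧺ (_ , u) y) ⟩
  (_ , φ-bit r) ⧺ (φʷ (_ , u) ⧺ φʷ y) ≡⟨ ⧺-assoc (_ , φ-bit r) (φʷ (_ , u)) (φʷ y) ⟨
  φʷ (_ , r ∷ u) ⧺ φʷ y              ∎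
  where open ≡-Reasoning

fibWord : (n : ℕ) → Vec Bool (F n)
fibWord 0             = false ∷ []
fibWord 1             = true ∷ []
fibWord (suc (suc n)) = fibWord (suc n) ++ fibWord n

F-nonZero : ∀ n → NonZero (F n)
F-nonZero 0 = _
F-nonZero 1 = _
F-nonZero (suc (suc n)) with F (suc n) | F-nonZero (suc n)
... | suc _ | _ = _

fib2-⊗ : ∀ m n → fib2 m n ≡ fibWord m ⊗ fibWord n
fib2-⊗ 0 0 = refl
fib2-⊗ 0 1 = refl
fib2-⊗ 1 0 = refl
fib2-⊗ 1 1 = refl
fib2-⊗ 0 (suc (suc n)) =
  trans (cong₂ _∘c_ (fib2-⊗ 0 (suc n)) (fib2-⊗ 0 n)) (⊗-++ʳ (fibWord 0) (fibWord (suc n)) (fibWord n))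
fib2-⊗ 1 (suc (suc n)) =
  trans (cong₂ _∘c_ (fib2-⊗ 1 (suc n)) (fib2-⊗ 1 n)) (⊗-++ʳ (fibWord 1) (fibWord (suc n)) (fibWord n))
fib2-⊗ (suc (suc m)) n =
  trans (cong₂ _∘r_ (fib2-⊗ (suc m) n) (fib2-⊗ m n)) (⊗-++ˡ (fibWord (suc m)) (fibWord m) (fibWord n))

φʷ-fibWord : ∀ n → φʷ (F n , fibWord n) ≡ (F (suc n) , fibWord (suc n))
φʷ-fibWord 0             = refl
φʷ-fibWord 1             = refl
φʷ-fibWord (suc (suc n)) =
  trans (φʷ-⧺ (_ , fibWord (suc n)) (_ , fibWord n)) (cong₂ _⧺_ (φʷ-fibWord (suc n)) (φʷ-fibWord n))

μ-fibArr : ∀ m n → μ (fibArr m n) ≡ just (fibArr (suc m) (suc n))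
μ-fibArr m n = begin
  μ (fibArr m n)                                        ≡⟨ cong (λ x → μ (_ , _ , x)) (fib2-⊗ m n) ⟩
  μ ((F m , fibWord m) ⊠ (F n , fibWord n))             ≡⟨ μ-⊗ (fibWord m) (fibWord n) ⦃ F-nonZero m ⦄ ⦃ F-nonZero n ⦄ ⟩
  just (φʷ (F m , fibWord m) ⊠ φʷ (F n , fibWord n))    ≡⟨ cong just (cong₂ _⊠_ (φʷ-fibWord m) (φʷ-fibWord n)) ⟩
  just ((_ , fibWord (suc m)) ⊠ (_ , fibWord (suc n)))  ≡⟨ cong (λ x → just (_ , _ , x)) (fib2-⊗ (suc m) (suc n)) ⟨
  just (fibArr (suc m) (suc n))                         ∎
  where open ≡-Reasoning

μ^-fibArr : ∀ k m n → μ^ k (fibArr m n) ≡ just (fibArr (k + m) (k + n))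
μ^-fibArr zero    m n = refl
μ^-fibArr (suc k) m n rewrite μ^-fibArr k m n = μ-fibArr (k + m) (k + n)

m+[n∸m+1]≡1+n : ∀ {m n} → m ≤ n → m + (n ∸ m + 1) ≡ suc n
m+[n∸m+1]≡1+n {m} {n} m≤n = begin
  m + (n ∸ m + 1)   ≡⟨ +-assoc m (n ∸ m) 1 ⟨
  m + (n ∸ m) + 1   ≡⟨ cong (_+ 1) (m+[n∸m]≡n m≤n) ⟩
  n + 1             ≡⟨ +-comm n 1 ⟩
  suc n             ∎
  where open ≡-Reasoning

corollary4 : (m n : ℕ) → 2 ≤ m → 2 ≤ n → m ≢ n →
    (m < n → μ^ (m ∸ 1) (fibArr 1 (n ∸ m + 1)) ≡ just (fibArr m n))
    × (n < m → μ^ (n ∸ 1) (fibArr (m ∸ n + 1) 1) ≡ just (fibArr m n))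
corollary4 (suc m) (suc n) _ _ _ = below , above
  where
  below : suc m < suc n → μ^ m (fibArr 1 (n ∸ m + 1)) ≡ just (fibArr (suc m) (suc n))
  below (s≤s m<n) = trans (μ^-fibArr m 1 (n ∸ m + 1))
    (cong just (cong₂ fibArr (+-comm m 1) (m+[n∸m+1]≡1+n (<⇒≤ m<n))))
  above : suc n < suc m → μ^ n (fibArr (m ∸ n + 1) 1) ≡ just (fibArr (suc m) (suc n))
  above (s≤s n<m) = trans (μ^-fibArr n (m ∸ n + 1) 1)
    (cong just (cong₂ fibArr (m+[n∸m+1]≡1+n (<⇒≤ n<m)) (+-comm n 1)))
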